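{- For every integer $n\ge 4$, let $(\beta_M-\beta_E)(n)$ denote the maximum of $\beta_M(G)-\beta_E(G)$ over all connected graphs $G$ of order $n$. Then $$\left\lfloor \tfrac{n}{2}\right\rfloor-1\le (\beta_M-\beta_E)(n)\le n-2.$$
   Context: All graphs are simple, undirected, finite and connected; $d(u,v)$ is the shortest-path distance between vertices $u,v$. For an edge $uv$ and a vertex $w$, $d(uv,w)=\min\{d(u,w),d(v,w)\}$. A vertex $w$ resolves two items $a,b$ (vertices or edges) if $d(a,w)\neq d(b,w)$. A vertex set $S\subseteq V(G)$ is an edge resolving set if every two distinct edges of $G$ are resolved by some vertex of $S$; the edge metric dimension $\beta_E(G)$ is the minimum cardinality of an edge resolving set. $S$ is a mixed resolving set if every two distinct elements of $V(G)\cup E(G)$ are resolved by some vertex of $S$; the mixed metric dimension $\beta_M(G)$ is the minimum cardinality of a mixed resolving set. -}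

module Defs where

open import Data.Bool using (Bool; true; false; T; _∧_; _∨_; if_then_else_)
open import Data.Nat using (ℕ; zero; suc; _≤_; _⊓_)
open import Data.Fin using (Fin; _<_; _≟_)
open import Data.Fin.Subset using (Subset; _∈_; ∣_∣)
open import Data.List using (allFin)
open import Data.Bool.ListAction using (any)
open import Data.Product using (Σ; _×_; _,_; proj₁; proj₂; ∃; ∃-syntax)
open import Data.Sum using (_⊎_; inj₁; inj₂)
open import Relation.Nullary using (¬_)
open import Relation.Nullary.Decidable using (⌊_⌋)
open import Relation.Binary.PropositionalEquality using (_≡_)
open import Relation.Binary.Construct.Closure.ReflexiveTransitive using (Star)

record Graph (n : ℕ) : Set where
  field
    adj   : Fin n → Fin n → Bool
    sym   : ∀ u v → adj u v ≡ adj v u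
    irref : ∀ u → adj u u ≡ false
open Graph public

module _ {n : ℕ} (G : Graph n) where

  Adj : Fin n → Fin n → Set
  Adj u v = T (adj G u v)

  Connected : Set
  Connected = ∀ u v → Star Adj u v

  reach : ℕ → Fin n → Fin n → Bool
  reach zero    u v = ⌊ u ≟ v ⌋
  reach (suc k) u v = reach k u v ∨ any (λ w → reach k u w ∧ adj G w v) (allFin n)

  search : ℕ → ℕ → Fin n → Fin n → ℕ
  search k zero    u v = k
  search k (suc f) u v = if reach k u v then k else search (suc k) f u v

  -- shortest-path distance d(u,v) (exact for connected graphs)
  dist : Fin n → Fin n → ℕ
  dist u v = search 0 n u v

  Edge : Set
  Edge = Σ (Fin n × Fin n) λ p → (proj₁ p < proj₂ p) × Adj (proj₁ p) (proj₂ p)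

  ends : Edge → Fin n × Fin n
  ends = proj₁

  edist : Edge → Fin n → ℕ
  edist ((u , v) , _) w = dist u w ⊓ dist v w

  Item : Set
  Item = Fin n ⊎ Edge

  key : Item → Fin n ⊎ (Fin n × Fin n)
  key (inj₁ v) = inj₁ v
  key (inj₂ e) = inj₂ (ends e)

  idist : Item → Fin n → ℕ
  idist (inj₁ v) w = dist v w
  idist (inj₂ e) w = edist e w

  EdgeResolving : Subset n → Set
  EdgeResolving S = ∀ (e f : Edge) → ¬ (ends e ≡ ends f) →
                    ∃[ w ] (w ∈ S × ¬ (edist e w ≡ edist f w))

  MixedResolving : Subset n → Set
  MixedResolving S = ∀ (a b : Item) → ¬ (key a ≡ key b) →
                     ∃[ w ] (w ∈ S × ¬ (idist a w ≡ idist b w))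

  IsMinCard : (Subset n → Set) → ℕ → Set
  IsMinCard P k = (∃[ S ] (P S × ∣ S ∣ ≡ k)) × (∀ S → P S → k ≤ ∣ S ∣)

  IsEdgeMetricDim : ℕ → Set
  IsEdgeMetricDim = IsMinCard EdgeResolving

  IsMixedMetricDim : ℕ → Set
  IsMixedMetricDim = IsMinCard MixedResolving

{-# OPTIONS --safe #-}
-- All vertices form a mixed resolving set, so β_M ≤ n, which suffices when β_E ≥ 2;
-- and β_E ≥ 1 since G has two distinct edges. If a single vertex w resolves all edges, then w is a
-- leaf (two edges at w are both at distance 0 from it). Let x be its neighbour and y another
-- neighbour of x; then every vertex but x forms a mixed resolving set: for each neighbour a of x,
-- w or y is strictly closer to x than to a, separating a from the edge ax. Hence β_M ≤ n − 1.
--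
-- Take the caterpillar with spine s₀ … s_t, t = ⌊n/2⌋, and the remaining vertices as
-- pendants at s₁, s₂, …. Distances to the two spine ends determine every edge, so β_E ≤ 2; a leaf ℓ
-- with neighbour v belongs to every mixed resolving set, since only ℓ separates v from the edge ℓv,
-- and the caterpillar has t + 1 leaves.
module Submission where

open import Defs
open import Data.Bool using (true; false; T)
open import Data.Bool.Properties using (T-∨; T-∧; T-irrelevant; T?)
open import Data.Empty using (⊥-elim)
open import Data.Fin as Fin
  using (Fin; zero; suc; toℕ; fromℕ<; _↑ˡ_; _↑ʳ_; splitAt; join; punchIn; punchOut)
open import Data.Fin.Properties as FinP using (_≟_; <-cmp; all?; any?)
open import Data.Fin.Subset using (Subset; _∈_; _⊆_; ∣_∣; ⁅_⁆; _∪_; ∁; ⊤; inside; outside)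
open import Data.Fin.Subset.Properties as SubsetP using (p⊆q⇒∣p∣≤∣q∣; p⊂q⇒∣p∣<∣q∣; ∈⊤)
open import Data.List using (allFin)
open import Data.List.Membership.Propositional.Properties using (∈-allFin)
open import Data.List.Relation.Unary.Any as Any using (satisfied)
open import Data.List.Relation.Unary.Any.Properties using (any⁺; any⁻)
open import Data.Nat as ℕ using (ℕ; zero; suc; _+_; _∸_; _⊓_; _≤_; _<_; z≤n; s≤s; _/_)
import Data.Nat.DivMod as DivModP
open import Data.Nat.Properties as ℕP using (≤-refl; ≤-trans; ≤-reflexive; n≤1+n; m≤m+n)
open import Data.Product using (Σ-syntax; _×_; _,_; proj₁; proj₂; ∃; ∃-syntax; ∃₂)
import Data.Product.Properties as ProductP
open import Data.Sum using (_⊎_; inj₁; inj₂; [_,_]; [_,_]′)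
import Data.Sum.Properties as SumP
import Data.Vec.Base as Vec
open import Data.Vec.Base using (_∷_; [])
import Data.Vec.Properties as VecP
open import Function using (_∘_; Equivalence; mk⇔)
open import Relation.Binary.Construct.Closure.ReflexiveTransitive using (Star; ε; _◅_; _◅◅_; reverse)
open import Relation.Binary.Definitions using (tri<; tri≈; tri>)
open import Relation.Binary.PropositionalEquality as ≡ using (_≡_; _≢_; refl; cong; cong₂; subst)
open import Relation.Nullary using (¬_; Dec; yes; no)
open import Relation.Nullary.Decidable
  using (⌊_⌋; isYes≗does; does-⇔; dec-false; toWitness; fromWitness; map′; _×-dec_; _⊎-dec_; _→-dec_; ¬?)

⁅x⁆⊆p : ∀ {n x} {p : Subset n} → x ∈ p → ⁅ x ⁆ ⊆ p
⁅x⁆⊆p {x = x} {p} x∈p y∈⁅x⁆ = subst (_∈ p) (≡.sym (SubsetP.x∈⁅y⁆⇒x≡y x y∈⁅x⁆)) x∈p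

x∈p⇒1≤∣p∣ : ∀ {n x} {p : Subset n} → x ∈ p → 1 ≤ ∣ p ∣
x∈p⇒1≤∣p∣ {x = x} x∈p = ≤-trans (≤-reflexive (≡.sym (SubsetP.∣⁅x⁆∣≡1 x))) (p⊆q⇒∣p∣≤∣q∣ (⁅x⁆⊆p x∈p))

x,y∈p⇒2≤∣p∣ : ∀ {n x y} {p : Subset n} → x ∈ p → y ∈ p → x ≢ y → 2 ≤ ∣ p ∣
x,y∈p⇒2≤∣p∣ {x = x} {y} x∈p y∈p x≢y = subst (_< _) (SubsetP.∣⁅x⁆∣≡1 x)
  (p⊂q⇒∣p∣<∣q∣ (⁅x⁆⊆p x∈p , y , y∈p , x≢y ∘ ≡.sym ∘ SubsetP.x∈⁅y⁆⇒x≡y x))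

∣p∪q∣≤∣p∣+∣q∣ : ∀ {n} (p q : Subset n) → ∣ p ∪ q ∣ ≤ ∣ p ∣ + ∣ q ∣
∣p∪q∣≤∣p∣+∣q∣ []            []            = z≤n
∣p∪q∣≤∣p∣+∣q∣ (inside  ∷ p) (inside  ∷ q) =
  s≤s (≤-trans (∣p∪q∣≤∣p∣+∣q∣ p q) (ℕP.+-monoʳ-≤ ∣ p ∣ (n≤1+n ∣ q ∣)))
∣p∪q∣≤∣p∣+∣q∣ (inside  ∷ p) (outside ∷ q) = s≤s (∣p∪q∣≤∣p∣+∣q∣ p q)
∣p∪q∣≤∣p∣+∣q∣ (outside ∷ p) (inside  ∷ q) =
  ≤-trans (s≤s (∣p∪q∣≤∣p∣+∣q∣ p q)) (≤-reflexive (≡.sym (ℕP.+-suc ∣ p ∣ ∣ q ∣)))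
∣p∪q∣≤∣p∣+∣q∣ (outside ∷ p) (outside ∷ q) = ∣p∪q∣≤∣p∣+∣q∣ p q

∣p++q∣≡∣p∣+∣q∣ : ∀ {m k} (p : Subset m) (q : Subset k) → ∣ p Vec.++ q ∣ ≡ ∣ p ∣ + ∣ q ∣
∣p++q∣≡∣p∣+∣q∣ []            q = refl
∣p++q∣≡∣p∣+∣q∣ (inside  ∷ p) q = cong suc (∣p++q∣≡∣p∣+∣q∣ p q)
∣p++q∣≡∣p∣+∣q∣ (outside ∷ p) q = ∣p++q∣≡∣p∣+∣q∣ p q

∣L∣+k≤∣S∣ : ∀ m {k} (S : Subset (m + k)) (L : Subset m) →
            (∀ {i} → i ∈ L → (i ↑ˡ k) ∈ S) → (∀ j → (m ↑ʳ j) ∈ S) → ∣ L ∣ + k ≤ ∣ S ∣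
∣L∣+k≤∣S∣ m {k} S L L⊆S right⊆S with Vec.splitAt m S
... | xs , ys , refl =
  ≤-trans (ℕP.+-mono-≤ (p⊆q⇒∣p∣≤∣q∣ (left⁻ ∘ L⊆S)) k≤∣ys∣) (≤-reflexive (≡.sym (∣p++q∣≡∣p∣+∣q∣ xs ys)))
  where
  left⁻ : ∀ {i} → (i ↑ˡ k) ∈ xs Vec.++ ys → i ∈ xs
  left⁻ {i} i∈ = VecP.lookup⇒[]= i xs (≡.trans (≡.sym (VecP.lookup-++ˡ xs ys i)) (VecP.[]=⇒lookup i∈))

  right⁻ : ∀ {j} → (m ↑ʳ j) ∈ xs Vec.++ ys → j ∈ ys
  right⁻ {j} j∈ = VecP.lookup⇒[]= j ys (≡.trans (≡.sym (VecP.lookup-++ʳ xs ys j)) (VecP.[]=⇒lookup j∈))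

  k≤∣ys∣ : k ≤ ∣ ys ∣
  k≤∣ys∣ = ≤-trans (≤-reflexive (≡.sym (SubsetP.∣⊤∣≡n k))) (p⊆q⇒∣p∣≤∣q∣ {p = ⊤} (λ {j} _ → right⁻ (right⊆S j)))

unit-step⇒≤ : ∀ {m n} → m ≡ suc n ⊎ n ≡ suc m → m ≤ suc n × n ≤ suc m
unit-step⇒≤ (inj₁ refl) = ≤-refl , ℕP.m≤n⇒m≤1+n (n≤1+n _)
unit-step⇒≤ (inj₂ refl) = ℕP.m≤n⇒m≤1+n (n≤1+n _) , ≤-refl

crossing : ∀ {A : Set} {R : A → A → Set} {P : A → Set} → (∀ x → Dec (P x)) →
           ∀ {v w} → Star R v w → ¬ P v → P w → ∃₂ λ a b → ¬ P a × P b × R a b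
crossing P? ε ¬Pv Pw = ⊥-elim (¬Pv Pw)
crossing P? {v} (_◅_ {j = v′} r rs) ¬Pv Pw with P? v′
... | yes Pv′ = v , v′ , ¬Pv , Pv′ , r
... | no ¬Pv′ = crossing P? rs ¬Pv′ Pw

avoid-one : ∀ {n} → 2 ≤ n → (a : Fin n) → ∃[ c ] c ≢ a
avoid-one {suc (suc _)} (s≤s (s≤s _)) a = punchIn a zero , FinP.punchInᵢ≢i a zero

avoid-two : ∀ {n} → 3 ≤ n → (a b : Fin n) → a ≢ b → ∃[ c ] (c ≢ a × c ≢ b)
avoid-two {suc (suc (suc _))} (s≤s (s≤s (s≤s _))) a b a≢b = punchIn a c′ , FinP.punchInᵢ≢i a c′ , c≢b
  where
  b′ c′ : Fin (suc (suc _))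
  b′ = punchOut a≢b
  c′ = punchIn b′ zero

  c≢b : punchIn a c′ ≢ b
  c≢b c≡b = FinP.punchInᵢ≢i b′ zero
    (FinP.punchIn-injective a c′ b′ (≡.trans c≡b (≡.sym (FinP.punchIn-punchOut a≢b))))

module Distance {n : ℕ} (G : Graph n) where

  adj-sym : ∀ {u v} → Adj G u v → Adj G v u
  adj-sym {u} {v} = subst T (Graph.sym G u v)

  adj-irrefl : ∀ {u v} → Adj G u v → u ≢ v
  adj-irrefl {u} a refl = subst T (Graph.irref G u) a

  reach-weaken : ∀ k {u v} → T (reach G k u v) → T (reach G (suc k) u v)
  reach-weaken k r = Equivalence.from T-∨ (inj₁ r)

  reach-refl : ∀ k u → T (reach G k u u)
  reach-refl zero    u = fromWitness refl
  reach-refl (suc k) u = reach-weaken k (reach-refl k u)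

  reach-snoc : ∀ k {u w v} → T (reach G k u w) → Adj G w v → T (reach G (suc k) u v)
  reach-snoc k {w = w} r a = Equivalence.from T-∨
    (inj₂ (any⁺ _ (Any.map (λ { refl → Equivalence.from T-∧ (r , a) }) (∈-allFin w))))

  reach-suc⁻ : ∀ k {u v} → T (reach G (suc k) u v) →
               T (reach G k u v) ⊎ ∃[ w ] (T (reach G k u w) × Adj G w v)
  reach-suc⁻ k r with Equivalence.to T-∨ r
  ... | inj₁ r′ = inj₁ r′
  ... | inj₂ r′ with satisfied (any⁻ _ (allFin n) r′)
  ...   | w , rw = inj₂ (w , Equivalence.to T-∧ rw)

  reach-cons : ∀ k {u w v} → Adj G u w → T (reach G k w v) → T (reach G (suc k) u v)
  reach-cons zero    {u} a r with toWitness r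
  ... | refl = reach-snoc 0 (reach-refl 0 u) a
  reach-cons (suc k) a r with reach-suc⁻ k r
  ... | inj₁ r′           = reach-weaken (suc k) (reach-cons k a r′)
  ... | inj₂ (x , r′ , b) = reach-snoc (suc k) (reach-cons k a r′) b

  reach-uncons : ∀ k {u v} → T (reach G k u v) →
                 u ≡ v ⊎ ∃₂ λ k′ w → suc k′ ≤ k × Adj G u w × T (reach G k′ w v)
  reach-uncons zero    r = inj₁ (toWitness r)
  reach-uncons (suc k) r with reach-suc⁻ k r
  ... | inj₁ r′ with reach-uncons k r′
  ...   | inj₁ u≡v                    = inj₁ u≡v
  ...   | inj₂ (k′ , w , lt , a , s) = inj₂ (k′ , w , ℕP.m≤n⇒m≤1+n lt , a , s)
  reach-uncons (suc k) r | inj₂ (x , r′ , b) with reach-uncons k r′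
  ...   | inj₁ refl                   = inj₂ (k , _ , ≤-refl , b , reach-refl k _)
  ...   | inj₂ (k′ , w , lt , a , s) = inj₂ (suc k′ , w , s≤s lt , a , reach-snoc k′ s b)

  reach⇒star : ∀ k {u v} → T (reach G k u v) → Star (Adj G) u v
  reach⇒star zero r with toWitness r
  ... | refl = ε
  reach⇒star (suc k) r with reach-suc⁻ k r
  ... | inj₁ r′           = reach⇒star k r′
  ... | inj₂ (w , r′ , a) = reach⇒star k r′ ◅◅ (a ◅ ε)

  search-least : ∀ k f {u v j} → T (reach G j u v) → k ≤ j → search G k f u v ≤ j
  search-least k zero    r k≤j = k≤j
  search-least k (suc f) {u} {v} r k≤j with reach G k u v in eq
  ... | true  = k≤j
  ... | false = search-least (suc k) f r (ℕP.≤∧≢⇒< k≤j λ { refl → subst T eq r })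

  search-≤ : ∀ k f u v → search G k f u v ≤ k + f
  search-≤ k zero    u v = m≤m+n k 0
  search-≤ k (suc f) u v with reach G k u v
  ... | true  = m≤m+n k (suc f)
  ... | false = ≤-trans (search-≤ (suc k) f u v) (≤-reflexive (≡.sym (ℕP.+-suc k f)))

  search-found : ∀ k f u v → search G k f u v ≡ k + f ⊎ T (reach G (search G k f u v) u v)
  search-found k zero    u v = inj₁ (≡.sym (ℕP.+-identityʳ k))
  search-found k (suc f) u v with reach G k u v in eq
  ... | true  = inj₂ (subst T (≡.sym eq) _)
  ... | false with search-found (suc k) f u v
  ...   | inj₁ e = inj₁ (≡.trans e (≡.sym (ℕP.+-suc k f)))
  ...   | inj₂ r = inj₂ r

  dist-least : ∀ {j u v} → T (reach G j u v) → dist G u v ≤ j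
  dist-least r = search-least 0 n r z≤n

  dist-≤ : ∀ u v → dist G u v ≤ n
  dist-≤ = search-≤ 0 n

  -- The junk value dist u v = n is returned when no walk of length < n joins u to v.
  dist-found : ∀ u v → dist G u v ≡ n ⊎ T (reach G (dist G u v) u v)
  dist-found = search-found 0 n

  dist-refl : ∀ u → dist G u u ≡ 0
  dist-refl u = ℕP.n≤0⇒n≡0 (dist-least (reach-refl 0 u))

  dist≡0⇒≡ : ∀ {u v} → dist G u v ≡ 0 → u ≡ v
  dist≡0⇒≡ {u} {v} d≡0 with dist-found u v
  ... | inj₁ d≡n = ⊥-elim (FinP.¬Fin0 (subst Fin (≡.trans (≡.sym d≡n) d≡0) u))
  ... | inj₂ r   = toWitness (subst (λ k → T (reach G k u v)) d≡0 r)

  dist-adj : ∀ {u v} → Adj G u v → dist G u v ≡ 1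
  dist-adj {u} a = ℕP.≤-antisym (dist-least (reach-snoc 0 (reach-refl 0 u) a))
                                 (ℕP.n≢0⇒n>0 (adj-irrefl a ∘ dist≡0⇒≡))

  dist≡1⇒adj : 2 ≤ n → ∀ {u v} → dist G u v ≡ 1 → Adj G u v
  dist≡1⇒adj 2≤n {u} {v} d≡1 with dist-found u v
  ... | inj₁ d≡n = ⊥-elim (ℕP.<⇒≢ 2≤n (≡.trans (≡.sym d≡1) d≡n))
  ... | inj₂ r with reach-suc⁻ 0 (subst (λ k → T (reach G k u v)) d≡1 r)
  ...   | inj₁ r₀ with toWitness r₀
  ...     | refl = ⊥-elim (ℕP.0≢1+n (≡.trans (≡.sym (dist-refl u)) d≡1))
  dist≡1⇒adj 2≤n d≡1 | inj₂ r | inj₂ (w , r₀ , a) with toWitness r₀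
  ...     | refl = a

  1<dist : 2 ≤ n → ∀ {u v} → u ≢ v → ¬ Adj G u v → 1 < dist G u v
  1<dist 2≤n {u} {v} u≢v ¬a with dist G u v in d
  ... | zero        = ⊥-elim (u≢v (dist≡0⇒≡ d))
  ... | suc zero    = ⊥-elim (¬a (dist≡1⇒adj 2≤n d))
  ... | suc (suc _) = s≤s (s≤s z≤n)

  leaf-neighbour-dist≤ : ∀ {ℓ v w} → Adj G ℓ v → (∀ u → Adj G ℓ u → u ≡ v) → ℓ ≢ w →
                         dist G v w ≤ dist G ℓ w
  leaf-neighbour-dist≤ {ℓ} {v} {w} _ only-v ℓ≢w with dist-found ℓ w
  ... | inj₁ d≡n = ≤-trans (dist-≤ v w) (≤-reflexive (≡.sym d≡n))
  ... | inj₂ r with reach-uncons (dist G ℓ w) r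
  ...   | inj₁ ℓ≡w                   = ⊥-elim (ℓ≢w ℓ≡w)
  ...   | inj₂ (k , x , k<d , a , s) with only-v x a
  ...     | refl = ≤-trans (dist-least s) (ℕP.<⇒≤ k<d)

  Lipschitz : (Fin n → ℕ) → Set
  Lipschitz f = ∀ a b → Adj G a b → f a ≤ suc (f b)

  lipschitz-reach : ∀ {f} → Lipschitz f → ∀ k {x y} → T (reach G k x y) → f x ≤ f y + k
  lipschitz-reach {f} L zero {x} r with toWitness r
  ... | refl = m≤m+n (f x) 0
  lipschitz-reach {f} L (suc k) {x} {y} r with reach-suc⁻ k r
  ... | inj₁ r′           = ≤-trans (lipschitz-reach L k r′) (ℕP.+-monoʳ-≤ (f y) (n≤1+n k))
  ... | inj₂ (w , r′ , a) = ≤-trans (lipschitz-reach L k r′)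
          (≤-trans (ℕP.+-monoˡ-≤ k (L w y a)) (≤-reflexive (≡.sym (ℕP.+-suc (f y) k))))

  record Descent (f : Fin n → ℕ) (s : Fin n) : Set where
    field
      target-zero : f s ≡ 0
      zero⇒target : ∀ x → f x ≡ 0 → x ≡ s
      descend     : ∀ x → f x ≢ 0 → ∃[ y ] (Adj G x y × suc (f y) ≡ f x)

  module _ {f : Fin n → ℕ} {s : Fin n} (D : Descent f s) where
    open Descent D

    descent-reach : ∀ x → T (reach G (f x) x s)
    descent-reach x = go (f x) x refl
      where
      go : ∀ k x → f x ≡ k → T (reach G k x s)
      go zero    x fx≡0 with zero⇒target x fx≡0
      ... | refl = reach-refl 0 x
      go (suc k) x fx≡1+k with descend x (λ fx≡0 → ℕP.1+n≢0 (≡.trans (≡.sym fx≡1+k) fx≡0))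
      ... | y , a , step = reach-cons k a (go k y (ℕP.suc-injective (≡.trans step fx≡1+k)))

    descent-connected : Connected G
    descent-connected u v =
      reach⇒star (f u) (descent-reach u) ◅◅ reverse adj-sym (reach⇒star (f v) (descent-reach v))

    descent-dist : Lipschitz f → (∀ x → f x ≤ n) → ∀ x → dist G x s ≡ f x
    descent-dist L f≤n x = ℕP.≤-antisym (dist-least (descent-reach x)) f≤dist
      where
      f≤dist : f x ≤ dist G x s
      f≤dist with dist-found x s
      ... | inj₁ d≡n = ≤-trans (f≤n x) (≤-reflexive (≡.sym d≡n))
      ... | inj₂ r   = ≤-trans (lipschitz-reach L _ r) (≤-reflexive (cong (_+ dist G x s) target-zero))

module Edges {n : ℕ} (G : Graph n) where
  open Distance G

  _∈E_ : Fin n → Edge G → Set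
  c ∈E e = c ≡ proj₁ (ends G e) ⊎ c ≡ proj₂ (ends G e)

  _∈E?_ : ∀ c e → Dec (c ∈E e)
  c ∈E? e = (c ≟ proj₁ (ends G e)) ⊎-dec (c ≟ proj₂ (ends G e))

  ∈E-resp-ends : ∀ {c} e f → ends G e ≡ ends G f → c ∈E e → c ∈E f
  ∈E-resp-ends {c} _ _ = subst (λ (p , q) → c ≡ p ⊎ c ≡ q)

  ∈E⇒edist≡0 : ∀ {c} e → c ∈E e → edist G e c ≡ 0
  ∈E⇒edist≡0 ((p , q) , _) (inj₁ refl) = cong (_⊓ dist G q p) (dist-refl p)
  ∈E⇒edist≡0 ((p , q) , _) (inj₂ refl) =
    ≡.trans (cong (dist G p q ⊓_) (dist-refl q)) (ℕP.⊓-zeroʳ (dist G p q))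

  edist≡0⇒∈E : ∀ {c} e → edist G e c ≡ 0 → c ∈E e
  edist≡0⇒∈E {c} ((p , q) , _) min≡0 with dist G p c in dp | dist G q c in dq
  ... | zero  | _    = inj₁ (≡.sym (dist≡0⇒≡ dp))
  ... | suc _ | zero = inj₂ (≡.sym (dist≡0⇒≡ dq))
  edist≡0⇒∈E ((p , q) , _) () | suc _ | suc _

  endpoint-resolves : ∀ {c} e f → c ∈E e → ¬ c ∈E f → edist G e c ≢ edist G f c
  endpoint-resolves e f c∈e c∉f eq = c∉f (edist≡0⇒∈E f (≡.trans (≡.sym eq) (∈E⇒edist≡0 e c∈e)))

  endpoints⊆⇒≡ : ∀ e f → (∀ {c} → c ∈E e → c ∈E f) → ends G e ≡ ends G f
  endpoints⊆⇒≡ ((p , q) , p<q , _) ((p′ , q′) , p′<q′ , _) e⊆f with e⊆f (inj₁ refl) | e⊆f (inj₂ refl)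
  ... | inj₁ refl | inj₂ refl = refl
  ... | inj₁ refl | inj₁ refl = ⊥-elim (FinP.<-irrefl refl p<q)
  ... | inj₂ refl | inj₂ refl = ⊥-elim (FinP.<-irrefl refl p<q)
  ... | inj₂ refl | inj₁ refl = ⊥-elim (FinP.<-asym p<q p′<q′)

  endpoint-apart : ∀ e f → ends G e ≢ ends G f → ∃[ c ] (c ∈E e × ¬ c ∈E f)
  endpoint-apart e f e≢f with proj₁ (ends G e) ∈E? f | proj₂ (ends G e) ∈E? f
  ... | no p∉f  | _       = _ , inj₁ refl , p∉f
  ... | yes _   | no q∉f  = _ , inj₂ refl , q∉f
  ... | yes p∈f | yes q∈f = ⊥-elim (e≢f (endpoints⊆⇒≡ e f [ (λ { refl → p∈f }) , (λ { refl → q∈f }) ]′))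

  edge : ∀ {u v} → Adj G u v → Edge G
  edge {u} {v} a with <-cmp u v
  ... | tri< u<v _ _ = (u , v) , u<v , a
  ... | tri≈ _ u≡v _ = ⊥-elim (adj-irrefl a u≡v)
  ... | tri> _ _ v<u = (v , u) , v<u , adj-sym a

  edge-ends : ∀ {u v} (a : Adj G u v) → ends G (edge a) ≡ (u , v) ⊎ ends G (edge a) ≡ (v , u)
  edge-ends {u} {v} a with <-cmp u v
  ... | tri< _ _ _   = inj₁ refl
  ... | tri≈ _ u≡v _ = ⊥-elim (adj-irrefl a u≡v)
  ... | tri> _ _ _   = inj₂ refl

  edist-edge : ∀ {u v} (a : Adj G u v) w → edist G (edge a) w ≡ dist G u w ⊓ dist G v w
  edist-edge {u} {v} a w with edge a | edge-ends a
  ... | _ | inj₁ refl = refl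
  ... | _ | inj₂ refl = ℕP.⊓-comm (dist G v w) (dist G u w)

  ∈E-edge : ∀ {u v c} (a : Adj G u v) → c ∈E edge a → c ≡ u ⊎ c ≡ v
  ∈E-edge a c∈e with edge a | edge-ends a
  ... | _ | inj₁ refl = c∈e
  ... | _ | inj₂ refl = Data.Sum.swap c∈e

  edge-∈E : ∀ {u v c} (a : Adj G u v) → c ≡ u ⊎ c ≡ v → c ∈E edge a
  edge-∈E a c∈uv with edge a | edge-ends a
  ... | _ | inj₁ refl = c∈uv
  ... | _ | inj₂ refl = Data.Sum.swap c∈uv

  incident-view : ∀ a e → ¬ a ∈E e ⊎ ∃[ z ] (Adj G a z × ∀ w → edist G e w ≡ dist G a w ⊓ dist G z w)
  incident-view a ((p , q) , _ , t) with a ≟ p | a ≟ q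
  ... | yes refl | _        = inj₂ (q , t , λ _ → refl)
  ... | no _     | yes refl = inj₂ (p , adj-sym t , λ w → ℕP.⊓-comm (dist G p w) (dist G a w))
  ... | no a≢p   | no a≢q   = inj₁ [ a≢p , a≢q ]′

module Connectivity {n : ℕ} (G : Graph n) (conn : Connected G) where
  open Distance G
  open Edges G

  neighbour : 2 ≤ n → ∀ u → ∃[ x ] Adj G u x
  neighbour 2≤n u with avoid-one 2≤n u
  ... | c , c≢u with crossing (_≟ u) (conn c u) c≢u refl
  ...   | a , _ , a≢u , refl , a~u = a , adj-sym a~u

  enter-pair : 3 ≤ n → ∀ {a b} → a ≢ b → ∃₂ λ c d → c ≢ a × c ≢ b × (d ≡ a ⊎ d ≡ b) × Adj G c d
  enter-pair 3≤n {a} {b} a≢b with avoid-two 3≤n a b a≢b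
  ... | v , v≢a , v≢b
    with crossing (λ z → (z ≟ a) ⊎-dec (z ≟ b)) (conn v a) [ v≢a , v≢b ]′ (inj₁ refl)
  ...   | c , d , c∉ab , d∈ab , c~d = c , d , c∉ab ∘ inj₁ , c∉ab ∘ inj₂ , d∈ab , c~d

  distinct-edges : 3 ≤ n → Fin n → ∃₂ λ e f → ends G e ≢ ends G f
  distinct-edges 3≤n u with neighbour (≤-trans (n≤1+n 2) 3≤n) u
  ... | x , u~x with enter-pair 3≤n (adj-irrefl u~x)
  ...   | c , d , c≢u , c≢x , _ , c~d = edge u~x , edge c~d , apart
    where
    apart : ends G (edge u~x) ≢ ends G (edge c~d)
    apart same = [ c≢u , c≢x ]′
      (∈E-edge u~x (∈E-resp-ends (edge c~d) (edge u~x) (≡.sym same) (edge-∈E c~d (inj₁ refl))))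

module Resolving {n : ℕ} (G : Graph n) where
  open Distance G
  open Edges G

  Separates : Subset n → Item G → Item G → Set
  Separates S a b = ∃[ w ] (w ∈ S × idist G a w ≢ idist G b w)

  separates-sym : ∀ {S a b} → Separates S a b → Separates S b a
  separates-sym (w , w∈S , ≢) = w , w∈S , ≢ ∘ ≡.sym

  module _ {S : Subset n} (x : Fin n) (others∈S : ∀ z → z ≢ x → z ∈ S)
           (near : ∀ a → Adj G a x → ∃[ w ] (w ∈ S × dist G x w < dist G a w)) where

    vertices-separated : ∀ a b → a ≢ b → Separates S (inj₁ a) (inj₁ b)
    vertices-separated a b a≢b with a ≟ x
    ... | no a≢x   = a , others∈S a a≢x , λ d → a≢b (≡.sym (dist≡0⇒≡ (≡.trans (≡.sym d) (dist-refl a))))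
    ... | yes refl = b , others∈S b (a≢b ∘ ≡.sym) , λ d → a≢b (dist≡0⇒≡ (≡.trans d (dist-refl b)))

    vertex-edge-separated : ∀ a e → Separates S (inj₁ a) (inj₂ e)
    vertex-edge-separated a e with incident-view a e
    vertex-edge-separated a e | inj₁ a∉e with a ≟ x
    ... | no a≢x   = a , others∈S a a≢x , λ d → a∉e (edist≡0⇒∈E e (≡.trans (≡.sym d) (dist-refl a)))
    ... | yes refl = c , others∈S c (λ c≡a → a∉e (subst (_∈E e) c≡a c∈e)) ,
                     λ d → a∉e (subst (_∈E e) (≡.sym (dist≡0⇒≡ (≡.trans d (∈E⇒edist≡0 e c∈e)))) c∈e)
      where
      c = proj₁ (ends G e)
      c∈e : c ∈E e
      c∈e = inj₁ refl
    vertex-edge-separated a e | inj₂ (z , a~z , edist≡) with z ≟ x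
    ... | no z≢x = z , others∈S z z≢x , λ d → adj-irrefl a~z (dist≡0⇒≡ (≡.trans d edist-e-z))
      where
      edist-e-z : edist G e z ≡ 0
      edist-e-z = ≡.trans (edist≡ z) (≡.trans (cong (dist G a z ⊓_) (dist-refl z)) (ℕP.⊓-zeroʳ _))
    ... | yes refl with near a a~z
    ...   | w , w∈S , closer = w , w∈S , λ d → ℕP.<⇒≢ closer
            (≡.sym (≡.trans d (≡.trans (edist≡ w) (ℕP.m≥n⇒m⊓n≡n (ℕP.<⇒≤ closer)))))

    edges-separated : ∀ e f → ends G e ≢ ends G f → Separates S (inj₂ e) (inj₂ f)
    edges-separated e f e≢f with endpoint-apart e f e≢f | endpoint-apart f e (e≢f ∘ ≡.sym)
    ... | c , c∈e , c∉f | c′ , c′∈f , c′∉e with c ≟ x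
    ...   | no c≢x   = c , others∈S c c≢x , endpoint-resolves e f c∈e c∉f
    ...   | yes refl = c′ , others∈S c′ (λ { refl → c′∉e c∈e }) , endpoint-resolves f e c′∈f c′∉e ∘ ≡.sym

    allBut-mixedResolving : MixedResolving G S
    allBut-mixedResolving (inj₁ a) (inj₁ b) a≢b = vertices-separated a b (a≢b ∘ cong inj₁)
    allBut-mixedResolving (inj₁ a) (inj₂ e) _   = vertex-edge-separated a e
    allBut-mixedResolving (inj₂ e) (inj₁ a) _   =
      separates-sym {a = inj₁ a} {b = inj₂ e} (vertex-edge-separated a e)
    allBut-mixedResolving (inj₂ e) (inj₂ f) e≢f = edges-separated e f (e≢f ∘ cong inj₂)

  ⊤-mixedResolving : Fin n → MixedResolving G ⊤
  ⊤-mixedResolving x = allBut-mixedResolving x (λ _ _ → ∈⊤) λ a a~x →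
    x , ∈⊤ , ≤-trans (≤-reflexive (cong suc (dist-refl x))) (ℕP.n≢0⇒n>0 (adj-irrefl a~x ∘ dist≡0⇒≡))

  -- Every vertex other than ℓ is at least as close to v as to ℓ, so only ℓ separates v from the edge ℓv.
  leaf-forced : ∀ {ℓ v S} → Adj G ℓ v → (∀ u → Adj G ℓ u → u ≡ v) → MixedResolving G S → ℓ ∈ S
  leaf-forced {ℓ} {v} ℓ~v only-v mr with mr (inj₁ v) (inj₂ (edge ℓ~v)) (λ ())
  ... | w , w∈S , d with ℓ ≟ w
  ...   | yes refl = w∈S
  ...   | no ℓ≢w   = ⊥-elim (d (≡.sym (≡.trans (edist-edge ℓ~v w)
                                          (ℕP.m≥n⇒m⊓n≡n (leaf-neighbour-dist≤ ℓ~v only-v ℓ≢w)))))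

  sole-resolver-leaf : ∀ {S w} → EdgeResolving G S → (∀ c → c ∈ S → c ≡ w) →
                       ∀ {x z} → Adj G w x → Adj G w z → x ≡ z
  sole-resolver-leaf {w = w} er only-w {x} {z} w~x w~z with x ≟ z
  ... | yes x≡z = x≡z
  ... | no x≢z with er (edge w~x) (edge w~z) apart
    where
    apart : ends G (edge w~x) ≢ ends G (edge w~z)
    apart same = [ adj-irrefl w~x ∘ ≡.sym , x≢z ]′
      (∈E-edge w~z (∈E-resp-ends (edge w~x) (edge w~z) same (edge-∈E w~x (inj₂ refl))))
  ...   | c , c∈S , d with only-w c c∈S
  ...     | refl = ⊥-elim (d (≡.trans (∈E⇒edist≡0 (edge w~x) (edge-∈E w~x (inj₁ refl)))
                                      (≡.sym (∈E⇒edist≡0 (edge w~z) (edge-∈E w~z (inj₁ refl))))))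

  leaf-neighbour-removable : 2 ≤ n → ∀ {w x y} → Adj G w x → (∀ z → Adj G w z → z ≡ x) →
                             Adj G y x → y ≢ w → MixedResolving G (∁ ⁅ x ⁆)
  leaf-neighbour-removable 2≤n {w} {x} {y} w~x only-x y~x y≢w = allBut-mixedResolving x others near
    where
    others : ∀ z → z ≢ x → z ∈ ∁ ⁅ x ⁆
    others z z≢x = SubsetP.x∉p⇒x∈∁p (z≢x ∘ SubsetP.x∈⁅y⁆⇒x≡y x)

    not-adjacent-to-w : ∀ {a} → Adj G a x → ¬ Adj G a w
    not-adjacent-to-w a~x a~w = adj-irrefl a~x (only-x _ (adj-sym a~w))

    near : ∀ a → Adj G a x → ∃[ u ] (u ∈ ∁ ⁅ x ⁆ × dist G x u < dist G a u)
    near a a~x with a ≟ w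
    ... | yes refl = y , others y (adj-irrefl y~x) , subst (_< dist G a y) (≡.sym (dist-adj (adj-sym y~x)))
                       (1<dist 2≤n (y≢w ∘ ≡.sym) (not-adjacent-to-w y~x ∘ adj-sym))
    ... | no a≢w   = w , others w (adj-irrefl w~x) , subst (_< dist G a w) (≡.sym (dist-adj (adj-sym w~x)))
                       (1<dist 2≤n a≢w (not-adjacent-to-w a~x))

module Decision {n : ℕ} (G : Graph n) where

  edge-proof-irrelevant : ∀ {u v} (c c′ : u Fin.< v × Adj G u v) → c ≡ c′
  edge-proof-irrelevant (u<v , a) (u<v′ , a′) = cong₂ _,_ (FinP.<-irrelevant u<v u<v′) (T-irrelevant a a′)

  all-edges? : {Q : Edge G → Set} → (∀ e → Dec (Q e)) → Dec (∀ e → Q e)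
  all-edges? {Q} Q? = map′ (λ h e → h _ _ (proj₂ e)) (λ h u v c → h ((u , v) , c)) (all? λ u → all? (at u))
    where
    at : ∀ u v → Dec (∀ c → Q ((u , v) , c))
    at u v with (u FinP.<? v) ×-dec T? (adj G u v)
    ... | no ¬c  = yes (λ c → ⊥-elim (¬c c))
    ... | yes c₀ = map′ (λ q c → subst (λ c → Q ((u , v) , c)) (edge-proof-irrelevant c₀ c) q)
                        (λ h → h c₀) (Q? ((u , v) , c₀))

  all-items? : {Q : Item G → Set} → (∀ a → Dec (Q a)) → Dec (∀ a → Q a)
  all-items? Q? = map′ (λ (h₁ , h₂) → [ h₁ , h₂ ]) (λ h → h ∘ inj₁ , h ∘ inj₂)
                       (all? (Q? ∘ inj₁) ×-dec all-edges? (Q? ∘ inj₂))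

  pair-≟ : (p q : Fin n × Fin n) → Dec (p ≡ q)
  pair-≟ = ProductP.≡-dec _≟_ _≟_

  key-≟ : (k k′ : Fin n ⊎ (Fin n × Fin n)) → Dec (k ≡ k′)
  key-≟ = SumP.≡-dec _≟_ pair-≟

  EdgesResolved : Subset n → Edge G → Edge G → Set
  EdgesResolved S e f = ¬ (ends G e ≡ ends G f) → ∃[ w ] (w ∈ S × ¬ (edist G e w ≡ edist G f w))

  edgesResolved? : ∀ S e f → Dec (EdgesResolved S e f)
  edgesResolved? S e f = ¬? (pair-≟ (ends G e) (ends G f)) →-dec
    any? λ w → (w SubsetP.∈? S) ×-dec ¬? (edist G e w ℕP.≟ edist G f w)

  edgeResolving? : ∀ S → Dec (EdgeResolving G S)
  edgeResolving? S = all-edges? λ e → all-edges? (edgesResolved? S e)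

  ItemsResolved : Subset n → Item G → Item G → Set
  ItemsResolved S a b = ¬ (key G a ≡ key G b) → ∃[ w ] (w ∈ S × ¬ (idist G a w ≡ idist G b w))

  itemsResolved? : ∀ S a b → Dec (ItemsResolved S a b)
  itemsResolved? S a b = ¬? (key-≟ (key G a) (key G b)) →-dec
    any? λ w → (w SubsetP.∈? S) ×-dec ¬? (idist G a w ℕP.≟ idist G b w)

  mixedResolving? : ∀ S → Dec (MixedResolving G S)
  mixedResolving? S = all-items? λ a → all-items? (itemsResolved? S a)

least-witness : {Q : ℕ → Set} → (∀ k → Dec (Q k)) → ∀ {m} → Q m → ∃[ k ] (Q k × ∀ j → Q j → k ≤ j)
least-witness {Q} Q? {m} Qm = search-up m 0 (ℕP.+-identityʳ m) (λ _ ())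
  where
  search-up : ∀ d k → d + k ≡ m → (∀ j → j < k → ¬ Q j) → ∃[ k ] (Q k × ∀ j → Q j → k ≤ j)
  search-up d k d+k≡m below with Q? k
  ... | yes Qk = k , Qk , λ j Qj → ℕP.≮⇒≥ (λ j<k → below j j<k Qj)
  search-up zero    k refl  below | no ¬Qk = ⊥-elim (¬Qk Qm)
  search-up (suc d) k d+k≡m below | no ¬Qk = search-up d (suc k) (≡.trans (ℕP.+-suc d k) d+k≡m)
    λ j j<1+k → [ below j , (λ { refl → ¬Qk }) ]′ (ℕP.m≤n⇒m<n∨m≡n (ℕP.≤-pred j<1+k))

minCard-exists : ∀ {n} (G : Graph n) {P : Subset n → Set} → (∀ S → Dec (P S)) →
                 ∀ {S} → P S → ∃ (IsMinCard G P)
minCard-exists G P? {S} PS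
  with least-witness (λ k → SubsetP.anySubset? (λ T → P? T ×-dec (∣ T ∣ ℕP.≟ k))) (S , PS , refl)
... | k , has-k , least = k , has-k , λ T PT → least ∣ T ∣ (T , PT , refl)

n≤2+k+[n∸2] : ∀ k {n} → 2 ≤ n → n ≤ suc (suc k) + (n ∸ 2)
n≤2+k+[n∸2] k {suc (suc n)} (s≤s (s≤s _)) = s≤s (s≤s (ℕP.m≤n+m n k))

module UpperBound {n : ℕ} (G : Graph n) (conn : Connected G) (3≤n : 3 ≤ n) where
  open Distance G
  open Resolving G
  open Connectivity G conn

  2≤n : 2 ≤ n
  2≤n = ≤-trans (n≤1+n 2) 3≤n

  some-edge-resolver : ∀ {S} → EdgeResolving G S → ∃[ w ] w ∈ S
  some-edge-resolver er with distinct-edges 3≤n (fromℕ< 3≤n)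
  ... | e , f , e≢f with er e f e≢f
  ...   | w , w∈S , _ = w , w∈S

  sole-edge-resolver⇒mixedResolving : ∀ {S w} → EdgeResolving G S → (∀ c → c ∈ S → c ≡ w) →
                                      ∃[ T ] (MixedResolving G T × ∣ T ∣ ≡ 1 + (n ∸ 2))
  sole-edge-resolver⇒mixedResolving {w = w} er only-w with neighbour 2≤n w
  ... | x , w~x with enter-pair 3≤n (adj-irrefl w~x)
  ...   | y , d , y≢w , y≢x , d∈wx , y~d = ∁ ⁅ x ⁆ , leaf-neighbour-removable 2≤n w~x only-x y~x y≢w , ∣V∖x∣
    where
    only-x : ∀ z → Adj G w z → z ≡ x
    only-x z w~z = sole-resolver-leaf er only-w w~z w~x

    y~x : Adj G y x
    y~x = [ (λ d≡w → ⊥-elim (y≢x (only-x y (adj-sym (subst (Adj G y) d≡w y~d)))))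
          , (λ d≡x → subst (Adj G y) d≡x y~d)
          ]′ d∈wx

    ∣V∖x∣ : ∣ ∁ ⁅ x ⁆ ∣ ≡ 1 + (n ∸ 2)
    ∣V∖x∣ = ≡.trans (SubsetP.∣∁p∣≡n∸∣p∣ ⁅ x ⁆) (≡.trans (cong (n ∸_) (SubsetP.∣⁅x⁆∣≡1 x)) (ℕP.+-∸-assoc 1 2≤n))

  mixed≤∣S∣+n∸2 : ∀ {bM S w} → (∀ T → MixedResolving G T → bM ≤ ∣ T ∣) →
                  EdgeResolving G S → w ∈ S → bM ≤ ∣ S ∣ + (n ∸ 2)
  mixed≤∣S∣+n∸2 {bM} {S} {w} minM er w∈S with ∣ S ∣ in ∣S∣≡k
  ... | zero        = ⊥-elim (ℕP.<⇒≢ (x∈p⇒1≤∣p∣ w∈S) (≡.sym ∣S∣≡k))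
  ... | suc zero    = let T , mr , ∣T∣ = sole-edge-resolver⇒mixedResolving er only-w
                      in ≤-trans (minM T mr) (≤-reflexive ∣T∣)
    where
    only-w : ∀ c → c ∈ S → c ≡ w
    only-w c c∈S with c ≟ w
    ... | yes c≡w = c≡w
    ... | no c≢w  = ⊥-elim (ℕP.<⇒≱ (subst (1 <_) ∣S∣≡k (x,y∈p⇒2≤∣p∣ c∈S w∈S c≢w)) ≤-refl)
  ... | suc (suc k) = begin
    bM                     ≤⟨ minM ⊤ (⊤-mixedResolving w) ⟩
    ∣ ⊤ {n} ∣              ≡⟨ SubsetP.∣⊤∣≡n n ⟩
    n                      ≤⟨ n≤2+k+[n∸2] k 2≤n ⟩
    suc (suc k) + (n ∸ 2)  ∎
    where open ℕP.≤-Reasoning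

mixedDim≤edgeDim+n∸2 : ∀ {n} → 4 ≤ n → ∀ (G : Graph n) → Connected G → ∀ bM bE →
                       IsMixedMetricDim G bM → IsEdgeMetricDim G bE → bM ≤ bE + (n ∸ 2)
mixedDim≤edgeDim+n∸2 4≤n G conn bM bE (_ , minM) ((S , er , refl) , _) =
  let w , w∈S = some-edge-resolver er in mixed≤∣S∣+n∸2 minM er w∈S
  where
  3≤n : 3 ≤ _
  3≤n = ≤-trans (n≤1+n 3) 4≤n
  open UpperBound G conn 3≤n using (some-edge-resolver; mixed≤∣S∣+n∸2)

DimensionGap : ℕ → ℕ → Set
DimensionGap m k = Σ[ G ∈ Graph m ] (Connected G × ∃[ bM ] ∃[ bE ]
                     (IsMixedMetricDim G bM × IsEdgeMetricDim G bE × k + bE ≤ bM))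

-- The caterpillar with spine s₀ … s_t and p pendant leaves, the j-th one hanging at s_{j+1}.
module Caterpillar (t p : ℕ) (p≤t : p ≤ t) where

  data Node : Set where
    spine   : ℕ → Node
    pendant : ℕ → Node

  data Link : Node → Node → Set where
    spine-link   : ∀ {i} → Link (spine i) (spine (suc i))
    pendant-link : ∀ {j} → Link (pendant j) (spine (suc j))

  Adjacent : Node → Node → Set
  Adjacent x y = Link x y ⊎ Link y x

  link? : ∀ x y → Dec (Link x y)
  link? (spine i)   (spine j)   with j ℕP.≟ suc i
  ... | yes refl = yes spine-link
  ... | no j≢1+i = no λ { spine-link → j≢1+i refl }
  link? (pendant j) (spine i)   with i ℕP.≟ suc j
  ... | yes refl = yes pendant-link
  ... | no i≢1+j = no λ { pendant-link → i≢1+j refl }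
  link? (spine _)   (pendant _) = no λ ()
  link? (pendant _) (pendant _) = no λ ()

  adjacent? : ∀ x y → Dec (Adjacent x y)
  adjacent? x y = link? x y ⊎-dec link? y x

  no-loop : ∀ {x} → ¬ Link x x
  no-loop ()

  Valid : Node → Set
  Valid (spine i)   = i ≤ t
  Valid (pendant j) = j < p

  node : Fin (suc t + p) → Node
  node u = [ spine ∘ toℕ , pendant ∘ toℕ ]′ (splitAt (suc t) u)

  vertex : (x : Node) → Valid x → Fin (suc t + p)
  vertex (spine i)   i≤t = fromℕ< (s≤s i≤t) ↑ˡ p
  vertex (pendant j) j<p = suc t ↑ʳ fromℕ< j<p

  node-valid : ∀ u → Valid (node u)
  node-valid u with splitAt (suc t) u
  ... | inj₁ i = ℕP.≤-pred (FinP.toℕ<n i)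
  ... | inj₂ j = FinP.toℕ<n j

  node-vertex : ∀ x (vx : Valid x) → node (vertex x vx) ≡ x
  node-vertex (spine i) i≤t
    rewrite FinP.splitAt-↑ˡ (suc t) (fromℕ< (s≤s i≤t)) p = cong spine (FinP.toℕ-fromℕ< (s≤s i≤t))
  node-vertex (pendant j) j<p
    rewrite FinP.splitAt-↑ʳ (suc t) p (fromℕ< j<p) = cong pendant (FinP.toℕ-fromℕ< j<p)

  node-injective : ∀ {u v} → node u ≡ node v → u ≡ v
  node-injective {u} {v} eq = begin
    u                                   ≡⟨ FinP.join-splitAt (suc t) p u ⟨
    join (suc t) p (splitAt (suc t) u)
      ≡⟨ cong (join (suc t) p) (kinds-injective (splitAt (suc t) u) (splitAt (suc t) v) eq) ⟩
    join (suc t) p (splitAt (suc t) v)  ≡⟨ FinP.join-splitAt (suc t) p v ⟩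
    v                                   ∎
    where
    open ≡.≡-Reasoning
    spine-injective : ∀ {a b} → spine a ≡ spine b → a ≡ b
    spine-injective refl = refl
    pendant-injective : ∀ {a b} → pendant a ≡ pendant b → a ≡ b
    pendant-injective refl = refl
    kinds-injective : ∀ a b → [ spine ∘ toℕ , pendant ∘ toℕ ]′ a ≡ [ spine ∘ toℕ , pendant ∘ toℕ ]′ b → a ≡ b
    kinds-injective (inj₁ i) (inj₁ i′) eq = cong inj₁ (FinP.toℕ-injective (spine-injective eq))
    kinds-injective (inj₂ j) (inj₂ j′) eq = cong inj₂ (FinP.toℕ-injective (pendant-injective eq))
    kinds-injective (inj₁ _) (inj₂ _) ()
    kinds-injective (inj₂ _) (inj₁ _) ()

  vertex-node : ∀ u → vertex (node u) (node-valid u) ≡ u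
  vertex-node u = node-injective (node-vertex (node u) (node-valid u))

  caterpillar : Graph (suc t + p)
  caterpillar = record
    { adj   = λ u v → ⌊ adjacent? (node u) (node v) ⌋
    ; sym   = λ u v → adjacent-sym (node u) (node v)
    ; irref = λ u → no-self-adjacency (node u)
    }
    where
    adjacent-sym : ∀ x y → ⌊ adjacent? x y ⌋ ≡ ⌊ adjacent? y x ⌋
    adjacent-sym x y = ≡.trans (isYes≗does (adjacent? x y))
      (≡.trans (does-⇔ (mk⇔ Data.Sum.swap Data.Sum.swap) (adjacent? x y) (adjacent? y x))
               (≡.sym (isYes≗does (adjacent? y x))))

    no-self-adjacency : ∀ x → ⌊ adjacent? x x ⌋ ≡ false
    no-self-adjacency x =
      ≡.trans (isYes≗does (adjacent? x x)) (dec-false (adjacent? x x) [ no-loop , no-loop ]′)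

  open Distance caterpillar
  open Edges caterpillar
  open Resolving caterpillar using (leaf-forced; ⊤-mixedResolving)

  adj⇒adjacent : ∀ {u v} → Adj caterpillar u v → Adjacent (node u) (node v)
  adj⇒adjacent = toWitness

  adjacent⇒adj : ∀ {x y} (vx : Valid x) (vy : Valid y) → Adjacent x y →
                 Adj caterpillar (vertex x vx) (vertex y vy)
  adjacent⇒adj {x} {y} vx vy a =
    fromWitness (≡.subst₂ Adjacent (≡.sym (node-vertex x vx)) (≡.sym (node-vertex y vy)) a)

  UnitSteps : (Node → ℕ) → Set
  UnitSteps F = ∀ {x y} → Link x y → Valid y → F x ≡ suc (F y) ⊎ F y ≡ suc (F x)

  unitSteps⇒lipschitz : ∀ {F} → UnitSteps F → Lipschitz (F ∘ node)
  unitSteps⇒lipschitz steps a b a~b with adj⇒adjacent {a} {b} a~b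
  ... | inj₁ l = proj₁ (unit-step⇒≤ (steps l (node-valid b)))
  ... | inj₂ l = proj₂ (unit-step⇒≤ (steps l (node-valid a)))

  lift-descent : (F : Node → ℕ) (s : Node) (vs : Valid s) → F s ≡ 0 →
                 (∀ x → Valid x → F x ≡ 0 → x ≡ s) →
                 (∀ x → Valid x → F x ≢ 0 → ∃[ y ] (Valid y × Adjacent x y × suc (F y) ≡ F x)) →
                 Descent (F ∘ node) (vertex s vs)
  lift-descent F s vs Fs≡0 zero⇒s descend = record
    { target-zero = ≡.trans (cong F (node-vertex s vs)) Fs≡0
    ; zero⇒target = λ u Fu≡0 →
        node-injective (≡.trans (zero⇒s (node u) (node-valid u) Fu≡0) (≡.sym (node-vertex s vs)))
    ; descend     = λ u Fu≢0 →
        let y , vy , a , step = descend (node u) (node-valid u) Fu≢0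
        in vertex y vy ,
           subst (λ v → Adj caterpillar v (vertex y vy)) (vertex-node u) (adjacent⇒adj (node-valid u) vy a) ,
           ≡.trans (cong (suc ∘ F) (node-vertex y vy)) step
    }

  F₀ : Node → ℕ
  F₀ (spine i)   = i
  F₀ (pendant j) = suc (suc j)

  F₀-steps : UnitSteps F₀
  F₀-steps spine-link   _ = inj₂ refl
  F₀-steps pendant-link _ = inj₁ refl

  F₀-descent : Descent (F₀ ∘ node) (vertex (spine 0) z≤n)
  F₀-descent = lift-descent F₀ (spine 0) z≤n refl zero⇒spine₀ descend
    where
    zero⇒spine₀ : ∀ x → Valid x → F₀ x ≡ 0 → x ≡ spine 0
    zero⇒spine₀ (spine zero) _ _ = refl

    descend : ∀ x → Valid x → F₀ x ≢ 0 → ∃[ y ] (Valid y × Adjacent x y × suc (F₀ y) ≡ F₀ x)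
    descend (spine zero)    _     0≢0 = ⊥-elim (0≢0 refl)
    descend (spine (suc i)) 1+i≤t _   = spine i , ℕP.<⇒≤ 1+i≤t , inj₂ spine-link , refl
    descend (pendant j)     j<p   _   = spine (suc j) , ≤-trans j<p p≤t , inj₁ pendant-link , refl

  Fₜ : Node → ℕ
  Fₜ (spine i)   = t ∸ i
  Fₜ (pendant j) = t ∸ j

  t∸i≡1+t∸[1+i] : ∀ {i} → suc i ≤ t → t ∸ i ≡ suc (t ∸ suc i)
  t∸i≡1+t∸[1+i] = ℕP.+-∸-assoc 1

  Fₜ-steps : UnitSteps Fₜ
  Fₜ-steps spine-link   1+i≤t = inj₁ (t∸i≡1+t∸[1+i] 1+i≤t)
  Fₜ-steps pendant-link 1+j≤t = inj₁ (t∸i≡1+t∸[1+i] 1+j≤t)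

  Fₜ-descent : Descent (Fₜ ∘ node) (vertex (spine t) ≤-refl)
  Fₜ-descent = lift-descent Fₜ (spine t) ≤-refl (ℕP.n∸n≡0 t) zero⇒spineₜ descend
    where
    zero⇒spineₜ : ∀ x → Valid x → Fₜ x ≡ 0 → x ≡ spine t
    zero⇒spineₜ (spine i)   i≤t t∸i≡0 = cong spine (ℕP.≤-antisym i≤t (ℕP.m∸n≡0⇒m≤n t∸i≡0))
    zero⇒spineₜ (pendant j) j<p t∸j≡0 = ⊥-elim (ℕP.<⇒≱ (≤-trans j<p p≤t) (ℕP.m∸n≡0⇒m≤n t∸j≡0))

    descend : ∀ x → Valid x → Fₜ x ≢ 0 → ∃[ y ] (Valid y × Adjacent x y × suc (Fₜ y) ≡ Fₜ x)
    descend (spine i)   _   t∸i≢0 = spine (suc i) , i<t , inj₁ spine-link , ≡.sym (t∸i≡1+t∸[1+i] i<t)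
      where
      i<t : i < t
      i<t = ℕP.≰⇒> (t∸i≢0 ∘ ℕP.m≤n⇒m∸n≡0)
    descend (pendant j) j<p _     = spine (suc j) , j<t , inj₁ pendant-link , ≡.sym (t∸i≡1+t∸[1+i] j<t)
      where
      j<t : j < t
      j<t = ≤-trans j<p p≤t

  caterpillar-connected : Connected caterpillar
  caterpillar-connected = descent-connected F₀-descent

  A B : Fin (suc t + p)
  A = vertex (spine 0) z≤n
  B = vertex (spine t) ≤-refl

  ≤1+t+p : ∀ {F : Node → ℕ} → (∀ x → Valid x → F x ≤ suc t) → ∀ u → F (node u) ≤ suc t + p
  ≤1+t+p F≤1+t u = ≤-trans (F≤1+t (node u) (node-valid u)) (m≤m+n (suc t) p)

  dist-A : ∀ u → dist caterpillar u A ≡ F₀ (node u)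
  dist-A = descent-dist F₀-descent (unitSteps⇒lipschitz {F₀} F₀-steps) (≤1+t+p {F₀} F₀≤1+t)
    where
    F₀≤1+t : ∀ x → Valid x → F₀ x ≤ suc t
    F₀≤1+t (spine i)   i≤t = ℕP.m≤n⇒m≤1+n i≤t
    F₀≤1+t (pendant j) j<p = s≤s (≤-trans j<p p≤t)

  dist-B : ∀ u → dist caterpillar u B ≡ Fₜ (node u)
  dist-B = descent-dist Fₜ-descent (unitSteps⇒lipschitz {Fₜ} Fₜ-steps) (≤1+t+p {Fₜ} Fₜ≤1+t)
    where
    Fₜ≤1+t : ∀ x → Valid x → Fₜ x ≤ suc t
    Fₜ≤1+t (spine i)   _ = ℕP.m≤n⇒m≤1+n (ℕP.m∸n≤m t i)
    Fₜ≤1+t (pendant j) _ = ℕP.m≤n⇒m≤1+n (ℕP.m∸n≤m t j)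

  Spans : Edge caterpillar → Node → Node → Set
  Spans ((p , q) , _) x y = (node p ≡ x × node q ≡ y) ⊎ (node p ≡ y × node q ≡ x)

  edge-link : ∀ e → ∃₂ λ x y → Link x y × Valid y × Spans e x y
  edge-link ((p , q) , _ , a) with adj⇒adjacent {p} {q} a
  ... | inj₁ l = node p , node q , l , node-valid q , inj₁ (refl , refl)
  ... | inj₂ l = node q , node p , l , node-valid p , inj₂ (refl , refl)

  edist-spans : ∀ {F : Node → ℕ} {s} → (∀ u → dist caterpillar u s ≡ F (node u)) →
                ∀ e {x y} → Spans e x y → edist caterpillar e s ≡ F x ⊓ F y
  edist-spans     d ((p , q) , _) (inj₁ (refl , refl)) = cong₂ _⊓_ (d p) (d q)
  edist-spans {F} d ((p , q) , _) (inj₂ (refl , refl)) =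
    ≡.trans (cong₂ _⊓_ (d p) (d q)) (ℕP.⊓-comm (F (node p)) (F (node q)))

  spans-edist-cong : ∀ {F : Node → ℕ} {s} → (∀ u → dist caterpillar u s ≡ F (node u)) →
                     ∀ e f {x y x′ y′} → Spans e x y → Spans f x′ y′ →
                     edist caterpillar e s ≡ edist caterpillar f s → F x ⊓ F y ≡ F x′ ⊓ F y′
  spans-edist-cong d e f σ σ′ eq = ≡.trans (≡.sym (edist-spans d e σ)) (≡.trans eq (edist-spans d f σ′))

  spans-∈E : ∀ e {x y} → Spans e x y → ∀ {c} → c ∈E e → node c ≡ x ⊎ node c ≡ y
  spans-∈E _ (inj₁ (refl , refl)) (inj₁ refl) = inj₁ refl
  spans-∈E _ (inj₁ (refl , refl)) (inj₂ refl) = inj₂ refl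
  spans-∈E _ (inj₂ (refl , refl)) (inj₁ refl) = inj₂ refl
  spans-∈E _ (inj₂ (refl , refl)) (inj₂ refl) = inj₁ refl

  ∈E-spans : ∀ e {x y} → Spans e x y → ∀ {c} → node c ≡ x ⊎ node c ≡ y → c ∈E e
  ∈E-spans _ (inj₁ (p↦x , q↦y)) (inj₁ c↦x) = inj₁ (node-injective (≡.trans c↦x (≡.sym p↦x)))
  ∈E-spans _ (inj₁ (p↦x , q↦y)) (inj₂ c↦y) = inj₂ (node-injective (≡.trans c↦y (≡.sym q↦y)))
  ∈E-spans _ (inj₂ (p↦y , q↦x)) (inj₁ c↦x) = inj₂ (node-injective (≡.trans c↦x (≡.sym q↦x)))
  ∈E-spans _ (inj₂ (p↦y , q↦x)) (inj₂ c↦y) = inj₁ (node-injective (≡.trans c↦y (≡.sym p↦y)))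

  Fₜ-min : ∀ {x y} → Link x y → Valid y → Fₜ x ⊓ Fₜ y ≡ Fₜ y
  Fₜ-min (spine-link {i}) 1+i≤t =
    ≡.trans (cong (_⊓ (t ∸ suc i)) (t∸i≡1+t∸[1+i] 1+i≤t)) (ℕP.m≥n⇒m⊓n≡n (n≤1+n _))
  Fₜ-min (pendant-link {j}) 1+j≤t =
    ≡.trans (cong (_⊓ (t ∸ suc j)) (t∸i≡1+t∸[1+i] 1+j≤t)) (ℕP.m≥n⇒m⊓n≡n (n≤1+n _))

  link-target : ∀ {x y} → Link x y → ∃[ i ] y ≡ spine (suc i)
  link-target spine-link   = _ , refl
  link-target pendant-link = _ , refl

  same-target : ∀ {x y x′ y′} → Link x y → Link x′ y′ → Valid y → Valid y′ → Fₜ y ≡ Fₜ y′ → y ≡ y′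
  same-target l l′ vy vy′ eq with link-target l | link-target l′
  ... | _ , refl | _ , refl = cong spine (ℕP.∸-cancelˡ-≡ vy vy′ eq)

  spine-min≢pendant-min : ∀ i → i ⊓ suc i ≢ suc (suc i) ⊓ suc i
  spine-min≢pendant-min i eq = ℕP.1+n≢n (≡.sym (begin
    i                    ≡⟨ ℕP.m≤n⇒m⊓n≡m (n≤1+n i) ⟨
    i ⊓ suc i            ≡⟨ eq ⟩
    suc (suc i) ⊓ suc i  ≡⟨ ℕP.m≥n⇒m⊓n≡n (n≤1+n (suc i)) ⟩
    suc i                ∎))
    where open ≡.≡-Reasoning

  same-source : ∀ {x x′ y} → Link x y → Link x′ y → F₀ x ⊓ F₀ y ≡ F₀ x′ ⊓ F₀ y → x ≡ x′
  same-source spine-link       spine-link       _  = refl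
  same-source pendant-link     pendant-link     _  = refl
  same-source (spine-link {i}) pendant-link     eq = ⊥-elim (spine-min≢pendant-min i eq)
  same-source pendant-link     (spine-link {i}) eq = ⊥-elim (spine-min≢pendant-min i (≡.sym eq))

  -- From (s₀, s_t) the spine edge s_i s_{i+1} is at distances (i, t ∸ suc i) and the pendant edge at
  -- s_{j+1} at (suc j, t ∸ suc j): the second distance fixes the spine vertex, the first the kind.
  ends-determined : ∀ e f → edist caterpillar e A ≡ edist caterpillar f A →
                    edist caterpillar e B ≡ edist caterpillar f B → ends caterpillar e ≡ ends caterpillar f
  ends-determined e f eA eB with edge-link e | edge-link f
  ... | x , y , l , vy , σ | x′ , y′ , l′ , vy′ , σ′
    with same-target l l′ vy vy′
           (≡.trans (≡.sym (Fₜ-min l vy)) (≡.trans (spans-edist-cong dist-B e f σ σ′ eB) (Fₜ-min l′ vy′)))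
  ... | refl with same-source l l′ (spans-edist-cong dist-A e f σ σ′ eA)
  ...   | refl = endpoints⊆⇒≡ e f (λ c∈e → ∈E-spans f σ′ (spans-∈E e σ c∈e))

  ends-edgeResolving : EdgeResolving caterpillar (⁅ A ⁆ ∪ ⁅ B ⁆)
  ends-edgeResolving e f e≢f with edist caterpillar e A ℕP.≟ edist caterpillar f A
                                | edist caterpillar e B ℕP.≟ edist caterpillar f B
  ... | no ≢A  | _      = A , SubsetP.x∈p∪q⁺ (inj₁ (SubsetP.x∈⁅x⁆ A)) , ≢A
  ... | yes _  | no ≢B  = B , SubsetP.x∈p∪q⁺ (inj₂ (SubsetP.x∈⁅x⁆ B)) , ≢B
  ... | yes eA | yes eB = ⊥-elim (e≢f (ends-determined e f eA eB))

  leaf-vertex-forced : ∀ {x y} (vx : Valid x) (vy : Valid y) → Adjacent x y →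
                       (∀ z → Valid z → Adjacent x z → z ≡ y) →
                       ∀ {S} → MixedResolving caterpillar S → vertex x vx ∈ S
  leaf-vertex-forced {x} {y} vx vy x~y only-y = leaf-forced (adjacent⇒adj vx vy x~y) only-vertex-y
    where
    only-vertex-y : ∀ u → Adj caterpillar (vertex x vx) u → u ≡ vertex y vy
    only-vertex-y u a = node-injective (≡.trans (only-y (node u) (node-valid u) x~u) (≡.sym (node-vertex y vy)))
      where
      x~u : Adjacent x (node u)
      x~u = subst (λ x′ → Adjacent x′ (node u)) (node-vertex x vx) (adj⇒adjacent {vertex x vx} {u} a)

  spine₀-neighbour : ∀ z → Valid z → Adjacent (spine 0) z → z ≡ spine 1
  spine₀-neighbour _ _ (inj₁ spine-link) = refl
  spine₀-neighbour _ _ (inj₂ ())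

  pendant-neighbour : ∀ {j} z → Valid z → Adjacent (pendant j) z → z ≡ spine (suc j)
  pendant-neighbour _ _ (inj₁ pendant-link) = refl
  pendant-neighbour _ _ (inj₂ ())

  spineₜ-neighbour : p < t → ∀ {i} → i ≡ t → ∀ z → Valid z → Adjacent (spine i) z → z ≡ spine (ℕ.pred i)
  spineₜ-neighbour _   i≡t _ 1+i≤t (inj₁ spine-link)   =
    ⊥-elim (ℕP.1+n≰n (subst (λ k → suc k ≤ t) i≡t 1+i≤t))
  spineₜ-neighbour _   _   _ _     (inj₂ spine-link)   = refl
  spineₜ-neighbour p<t i≡t _ j<p   (inj₂ pendant-link) =
    ⊥-elim (ℕP.<⇒≱ j<p (ℕP.≤-pred (subst (suc p ≤_) (≡.sym i≡t) p<t)))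

  mixedResolving⇒1+t≤∣S∣ : 1 ≤ t → t ≤ suc p → ∀ {S} → MixedResolving caterpillar S → suc t ≤ ∣ S ∣
  mixedResolving⇒1+t≤∣S∣ 1≤t t≤1+p {S} mr = [ far-end-is-leaf , no-far-leaf ]′ (ℕP.m≤n⇒m<n∨m≡n p≤t)
    where
    spine₀∈S : (zero ↑ˡ p) ∈ S
    spine₀∈S = leaf-vertex-forced z≤n 1≤t (inj₁ spine-link) spine₀-neighbour mr

    pendant∈S : ∀ j → (suc t ↑ʳ j) ∈ S
    pendant∈S j = subst (λ j′ → (suc t ↑ʳ j′) ∈ S) (FinP.fromℕ<-toℕ j (FinP.toℕ<n j))
      (leaf-vertex-forced (FinP.toℕ<n j) (≤-trans (FinP.toℕ<n j) p≤t) (inj₁ pendant-link) pendant-neighbour mr)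

    left∈S : ∀ {a i} → (a ↑ˡ p) ∈ S → i ∈ ⁅ a ⁆ → (i ↑ˡ p) ∈ S
    left∈S {a} a∈S i∈⁅a⁆ = subst (λ i → (i ↑ˡ p) ∈ S) (≡.sym (SubsetP.x∈⁅y⁆⇒x≡y a i∈⁅a⁆)) a∈S

    no-far-leaf : p ≡ t → suc t ≤ ∣ S ∣
    no-far-leaf p≡t = begin
      suc t       ≡⟨ cong suc p≡t ⟨
      suc p       ≡⟨ cong (_+ p) (SubsetP.∣⁅x⁆∣≡1 {n = suc t} zero) ⟨
      ∣ L ∣ + p   ≤⟨ ∣L∣+k≤∣S∣ (suc t) S L (left∈S spine₀∈S) pendant∈S ⟩
      ∣ S ∣       ∎
      where
      open ℕP.≤-Reasoning

      L : Subset (suc t)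
      L = ⁅ zero ⁆

    far-end-is-leaf : p < t → suc t ≤ ∣ S ∣
    far-end-is-leaf p<t = begin
      suc t      ≡⟨ cong suc t≡1+p ⟩
      2 + p      ≤⟨ ℕP.+-monoˡ-≤ p 2≤∣L∣ ⟩
      ∣ L ∣ + p  ≤⟨ ∣L∣+k≤∣S∣ (suc t) S L L∈S pendant∈S ⟩
      ∣ S ∣      ∎
      where
      open ℕP.≤-Reasoning

      t≡1+p : t ≡ suc p
      t≡1+p = ℕP.≤-antisym t≤1+p p<t

      1+p≤t : suc p ≤ t
      1+p≤t = ≤-reflexive (≡.sym t≡1+p)

      last : Fin (suc t)
      last = fromℕ< (s≤s 1+p≤t)

      L : Subset (suc t)
      L = ⁅ zero ⁆ ∪ ⁅ last ⁆

      2≤∣L∣ : 2 ≤ ∣ L ∣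
      2≤∣L∣ = x,y∈p⇒2≤∣p∣ (SubsetP.x∈p∪q⁺ {p = ⁅ zero ⁆} {q = ⁅ last ⁆} (inj₁ (SubsetP.x∈⁅x⁆ zero)))
                           (SubsetP.x∈p∪q⁺ (inj₂ (SubsetP.x∈⁅x⁆ last)))
                           (λ 0≡last → ℕP.0≢1+n (≡.trans (cong toℕ 0≡last) (FinP.toℕ-fromℕ< (s≤s 1+p≤t))))

      spineₜ∈S : (last ↑ˡ p) ∈ S
      spineₜ∈S = leaf-vertex-forced 1+p≤t p≤t (inj₂ spine-link) (spineₜ-neighbour p<t (≡.sym t≡1+p)) mr

      L∈S : ∀ {i} → i ∈ L → (i ↑ˡ p) ∈ S
      L∈S i∈L = [ left∈S spine₀∈S , left∈S spineₜ∈S ]′ (SubsetP.x∈p∪q⁻ ⁅ zero ⁆ ⁅ last ⁆ i∈L)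

  dimension-gap : 1 ≤ t → t ≤ suc p → ∀ {bM bE} →
                  IsMixedMetricDim caterpillar bM → IsEdgeMetricDim caterpillar bE → (t ∸ 1) + bE ≤ bM
  dimension-gap 1≤t t≤1+p {bM} {bE} ((SM , mrM , ∣SM∣≡bM) , _) (_ , minE) = begin
    (t ∸ 1) + bE       ≤⟨ ℕP.+-monoʳ-≤ (t ∸ 1) bE≤2 ⟩
    (t ∸ 1) + 2        ≡⟨ ℕP.+-comm (t ∸ 1) 2 ⟩
    suc (1 + (t ∸ 1))  ≡⟨ cong suc (ℕP.m+[n∸m]≡n 1≤t) ⟩
    suc t              ≤⟨ mixedResolving⇒1+t≤∣S∣ 1≤t t≤1+p mrM ⟩
    ∣ SM ∣             ≡⟨ ∣SM∣≡bM ⟩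
    bM                 ∎
    where
    open ℕP.≤-Reasoning

    bE≤2 : bE ≤ 2
    bE≤2 = ≤-trans (minE _ ends-edgeResolving) (≤-trans (∣p∪q∣≤∣p∣+∣q∣ ⁅ A ⁆ ⁅ B ⁆)
             (≤-reflexive (cong₂ _+_ (SubsetP.∣⁅x⁆∣≡1 A) (SubsetP.∣⁅x⁆∣≡1 B))))

  caterpillar-gap : 1 ≤ t → t ≤ suc p → DimensionGap (suc t + p) (t ∸ 1)
  caterpillar-gap 1≤t t≤1+p =
    let bM , dimM = minCard-exists caterpillar (Decision.mixedResolving? caterpillar) (⊤-mixedResolving A)
        bE , dimE = minCard-exists caterpillar (Decision.edgeResolving? caterpillar) ends-edgeResolving
    in caterpillar , caterpillar-connected , bM , bE , dimM , dimE , dimension-gap 1≤t t≤1+p dimM dimE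

split-in-halves : ∀ m → ∃₂ λ t p → suc m ≡ suc t + p × p ≤ t × t ≤ suc p × suc m / 2 ≡ t
split-in-halves zero          = 0 , 0 , refl , z≤n , z≤n , refl
split-in-halves (suc zero)    = 1 , 0 , refl , z≤n , s≤s z≤n , refl
split-in-halves (suc (suc m)) with split-in-halves m
... | t , p , m≡ , p≤t , t≤1+p , half =
  suc t , suc p , cong (2 +_) (≡.trans m≡ (≡.sym (ℕP.+-suc t p))) , s≤s p≤t , s≤s t≤1+p ,
  ≡.trans (DivModP.m/n≡1+[m∸n]/n {suc (suc (suc m))} {2} (s≤s (s≤s z≤n))) (cong suc half)

dimensionGap-attained : ∀ n → 4 ≤ n → DimensionGap n (n / 2 ∸ 1)
dimensionGap-attained (suc m) 4≤n with split-in-halves m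
... | t , p , n≡ , p≤t , t≤1+p , n/2≡t =
  ≡.subst₂ DimensionGap (≡.sym n≡) (cong (_∸ 1) (≡.sym n/2≡t)) (Caterpillar.caterpillar-gap t p p≤t 1≤t t≤1+p)
  where
  1≤t : 1 ≤ t
  1≤t = subst (1 ≤_) n/2≡t (DivModP.m≥n⇒m/n>0 (≤-trans (n≤1+n 2) (≤-trans (n≤1+n 3) 4≤n)))

theorem1 : ∀ (n : ℕ) → 4 ≤ n →
    (∀ (G : Graph n) → Connected G → ∀ (bM bE : ℕ) →
       IsMixedMetricDim G bM → IsEdgeMetricDim G bE → bM ≤ bE + (n ∸ 2))
    × (Σ[ G ∈ Graph n ] (Connected G × ∃[ bM ] ∃[ bE ]
       (IsMixedMetricDim G bM × IsEdgeMetricDim G bE × (n / 2 ∸ 1) + bE ≤ bM)))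
theorem1 n 4≤n = mixedDim≤edgeDim+n∸2 4≤n , dimensionGap-attained n 4≤n
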